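{- Let $n_1,n_2,n_3$ be nonnegative integers. For $r\ge0$ let $s_3(r;[n_1,n_2,n_3])$ be the number of sequences over $\{1,2,3\}$ containing exactly $n_j$ copies of $j$ ($j=1,2,3$) and exactly $r$ indices $t$ with $a_{t+1}-a_t=1$, and let $P_3(w;[n_1,n_2,n_3])=\sum_r s_3(r;[n_1,n_2,n_3])w^r$. Then $$P_3(w;[n_1,n_2,n_3])=\sum_{i=0}^{n_1}\sum_{j=0}^{n_2}\sum_{l=0}^{n_3}\binom{n_1+n_2+n_3-i-j-2l}{i,\ j,\ l,\ n_1-i-l,\ n_2-i-j-l,\ n_3-j-l}(w-1)^{i+j+2l},$$ where the sum is restricted to $(i,j,l)$ with $n_1-i-l\ge0$, $n_2-i-j-l\ge0$ and $n_3-j-l\ge0$, and the binomial-like symbol denotes the multinomial coefficient. -}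

module Defs where

open import Data.Nat using (ℕ; zero; suc; _+_; _*_; _∸_; _≤ᵇ_)
open import Data.Nat.Combinatorics using (_C_)
open import Data.Bool using (Bool; true; false; if_then_else_; _∧_)
open import Data.Fin using (Fin; toℕ)
import Data.Fin as Fin
open import Data.List using (List; []; _∷_; map; concatMap; filter; length)
open import Data.Nat.ListAction using (sum)
open import Data.Integer using (ℤ; _^_) renaming (_+_ to _+ℤ_; _*_ to _*ℤ_; _-_ to _-ℤ_)
import Data.Integer as ℤ
open import Relation.Nullary.Decidable using (does)
open import Relation.Binary.PropositionalEquality using (_≡_)

-- All sequences of length k over the alphabet Fin 3 (standing for {1,2,3}:
-- Fin.zero ↦ 1, suc zero ↦ 2, suc (suc zero) ↦ 3).
allSeqs : ℕ → List (List (Fin 3))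
allSeqs zero = [] ∷ []
allSeqs (suc k) = concatMap (λ xs → map (λ a → a ∷ xs) (Fin.zero ∷ Fin.suc Fin.zero ∷ Fin.suc (Fin.suc Fin.zero) ∷ [])) (allSeqs k)

count : Fin 3 → List (Fin 3) → ℕ
count c [] = 0
count c (a ∷ as) = (if does (c Fin.≟ a) then 1 else 0) + count c as

rises : List (Fin 3) → ℕ
rises [] = 0
rises (a ∷ []) = 0
rises (a ∷ b ∷ as) = (if does (toℕ b Data.Nat.≟ suc (toℕ a)) then 1 else 0) + rises (b ∷ as)
  where import Data.Nat

hasContent : ℕ → ℕ → ℕ → List (Fin 3) → Bool
hasContent n₁ n₂ n₃ as =
  does (count Fin.zero as Data.Nat.≟ n₁) ∧
  does (count (Fin.suc Fin.zero) as Data.Nat.≟ n₂) ∧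
  does (count (Fin.suc (Fin.suc Fin.zero)) as Data.Nat.≟ n₃)
  where import Data.Nat

words₃ : ℕ → ℕ → ℕ → List (List (Fin 3))
words₃ n₁ n₂ n₃ = filter (λ as → hasContent n₁ n₂ n₃ as Data.Bool.≟ true) (allSeqs (n₁ + n₂ + n₃))
  where import Data.Bool

s₃ : ℕ → ℕ → ℕ → ℕ → ℕ
s₃ r n₁ n₂ n₃ = length (filter (λ as → rises as Data.Nat.≟ r) (words₃ n₁ n₂ n₃))
  where import Data.Nat

sumTo : ℕ → (ℕ → ℤ) → ℤ
sumTo zero f = f 0
sumTo (suc n) f = sumTo n f +ℤ f (suc n)

-- P_3(w;[n1,n2,n3]) = Σ_r s_3(r) w^r  (r ranges over 0..n1+n2+n3; s_3 vanishes beyond)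
P₃ : ℤ → ℕ → ℕ → ℕ → ℤ
P₃ w n₁ n₂ n₃ = sumTo (n₁ + n₂ + n₃) (λ r → ℤ.+ (s₃ r n₁ n₂ n₃) *ℤ (w ^ r))

multinomial : List ℕ → ℕ
multinomial [] = 1
multinomial (k ∷ ks) = ((k + sum ks) C k) * multinomial ks

RHS₃ : ℤ → ℕ → ℕ → ℕ → ℤ
RHS₃ w n₁ n₂ n₃ =
  sumTo n₁ λ i → sumTo n₂ λ j → sumTo n₃ λ l →
    if (i + l ≤ᵇ n₁) ∧ (i + j + l ≤ᵇ n₂) ∧ (j + l ≤ᵇ n₃)
    then ℤ.+ (multinomial (i ∷ j ∷ l ∷ (n₁ ∸ i ∸ l) ∷ (n₂ ∸ i ∸ j ∸ l) ∷ (n₃ ∸ j ∸ l) ∷ []))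
           *ℤ ((w -ℤ ℤ.+ 1) ^ (i + j + 2 * l))
    else ℤ.+ 0

-- Both sides are functions f of (n₁, n₂, n₃) with f(0,0,0) = 1 which, for (n₁,n₂,n₃) ≠ 0, satisfy
--   f(n) = f(n−e₁) + f(n−e₂) + f(n−e₃) + x f(n−e₁−e₂) + x f(n−e₂−e₃) + x² f(n−e₁−e₂−e₃),
-- where x = w − 1 and f is read as 0 off ℕ³; hence they coincide.  For P₃, remove the first
-- letter a of a word: the rest gains a factor w = 1 + x exactly when it starts with a + 1, and
-- unfolding the possible initial runs 1, 2, 3, 12, 23, 123 gives the six terms.  For the
-- right-hand side it is the Pascal rule of the multinomial coefficient in its six parts
-- i, j, l, n₁−i−l, n₂−i−j−l, n₃−j−l, where the parts i, j, l carry the weights x, x, x².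

module Submission where

open import Algebra.Structures using (IsMagma)
open import Data.Bool as Bool using (true; false; if_then_else_; _∧_)
open import Data.Bool.Properties using (∧-zeroʳ)
open import Data.Empty using (⊥; ⊥-elim)
open import Data.Fin as Fin using (Fin; toℕ)
open import Data.Integer using (ℤ; +_; _+_; _*_; _-_; _^_; 0ℤ; 1ℤ)
import Data.Integer.Properties as ℤ
open import Data.Integer.Tactic.RingSolver using (solve-∀)
open import Data.List using (List; []; _∷_; _++_; map; concatMap; filter; length)
open import Data.List.Relation.Unary.All as All using (All; []; _∷_)
import Data.List.Relation.Unary.All.Properties as AllP
open import Data.Nat as ℕ using (ℕ; zero; suc)
import Data.Nat.Properties as ℕ
open import Data.Nat.Combinatorics using (_C_; nCn≡1; nCk+nC[k+1]≡[n+1]C[k+1])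
open import Data.Nat.Induction using (<-rec)
open import Data.Nat.ListAction using (sum)
import Data.Nat.Tactic.RingSolver as ℕ-Ring
open import Data.Product using (∃-syntax; _,_)
open import Data.Sum using (inj₁; inj₂)
open import Relation.Binary.PropositionalEquality
open import Relation.Nullary using (does; contradiction)
open import Relation.Nullary.Decidable using (dec-true; dec-false)
open import Relation.Unary using (Decidable)

open import Defs

open ≡-Reasoning
open IsMagma ℤ.+-isMagma using () renaming (∙-congˡ to +-congˡ; ∙-congʳ to +-congʳ)
open import Algebra.Properties.CommutativeSemigroup ℤ.+-commutativeSemigroup
  using () renaming (interchange to +-interchange)

atSub : ℕ → ℕ → (ℕ → ℤ) → ℤ
atSub zero    n       f = f n
atSub (suc k) zero    f = 0ℤ
atSub (suc k) (suc n) f = atSub k n f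

atPred : ℕ → (ℕ → ℤ) → ℤ
atPred = atSub 1

atSub-cong : ∀ k n {f g : ℕ → ℤ} → (∀ a → k ℕ.+ a ≡ n → f a ≡ g a) → atSub k n f ≡ atSub k n g
atSub-cong zero    n       h = h n refl
atSub-cong (suc k) zero    h = refl
atSub-cong (suc k) (suc n) h = atSub-cong k n λ a e → h a (cong suc e)

atPred-cong : ∀ n {f g : ℕ → ℤ} → (∀ m → suc m ≡ n → f m ≡ g m) → atPred n f ≡ atPred n g
atPred-cong = atSub-cong 1

atSub-zero : ∀ k n → atSub k n (λ _ → 0ℤ) ≡ 0ℤ
atSub-zero zero    n       = refl
atSub-zero (suc k) zero    = refl
atSub-zero (suc k) (suc n) = atSub-zero k n

atSub-+ : ∀ k n (f g : ℕ → ℤ) → atSub k n (λ a → f a + g a) ≡ atSub k n f + atSub k n g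
atSub-+ zero    n       f g = refl
atSub-+ (suc k) zero    f g = refl
atSub-+ (suc k) (suc n) f g = atSub-+ k n f g

atSub-* : ∀ k n c (f : ℕ → ℤ) → atSub k n (λ a → c * f a) ≡ c * atSub k n f
atSub-* zero    n       c f = refl
atSub-* (suc k) zero    c f = sym (ℤ.*-zeroʳ c)
atSub-* (suc k) (suc n) c f = atSub-* k n c f

atPred-*ʳ : ∀ n (f : ℕ → ℤ) y → atPred n (λ m → f m * y) ≡ atPred n f * y
atPred-*ʳ zero    f y = sym (ℤ.*-zeroˡ y)
atPred-*ʳ (suc n) f y = refl

atSub-atSub : ∀ k k′ n (f : ℕ → ℤ) → atSub k n (λ a → atSub k′ a f) ≡ atSub (k ℕ.+ k′) n f
atSub-atSub zero    k′ n       f = refl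
atSub-atSub (suc k) k′ zero    f = refl
atSub-atSub (suc k) k′ (suc n) f = atSub-atSub k k′ n f

atSub-comm : ∀ k n k′ n′ (g : ℕ → ℕ → ℤ) →
  atSub k n (λ a → atSub k′ n′ (g a)) ≡ atSub k′ n′ (λ b → atSub k n (λ a → g a b))
atSub-comm zero    n       k′ n′ g = refl
atSub-comm (suc k) zero    k′ n′ g = sym (atSub-zero k′ n′)
atSub-comm (suc k) (suc n) k′ n′ g = atSub-comm k n k′ n′ g

atSub-commutes : ∀ {I : Set} (L : (I → ℤ) → ℤ) → L (λ _ → 0ℤ) ≡ 0ℤ →
  ∀ k n (g : I → ℕ → ℤ) → L (λ i → atSub k n (g i)) ≡ atSub k n (λ a → L (λ i → g i a))
atSub-commutes L L-zero zero    n       g = refl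
atSub-commutes L L-zero (suc k) zero    g = L-zero
atSub-commutes L L-zero (suc k) (suc n) g = atSub-commutes L L-zero k n g

atSub-if : ∀ k n (f : ℕ → ℤ) → atSub k n f ≡ (if k ℕ.≤ᵇ n then f (n ℕ.∸ k) else 0ℤ)
atSub-if zero    n       f = refl
atSub-if (suc k) zero    f = refl
atSub-if (suc k) (suc n) f = trans (atSub-if k n f) (cong (if_then f (n ℕ.∸ k) else 0ℤ) (≤ᵇ⇒<ᵇ-suc k))
  where
  ≤ᵇ⇒<ᵇ-suc : ∀ k → (k ℕ.≤ᵇ n) ≡ (k ℕ.<ᵇ suc n)
  ≤ᵇ⇒<ᵇ-suc zero    = refl
  ≤ᵇ⇒<ᵇ-suc (suc k) = refl

-- The multinomial Pascal rule

pascalSum : (List ℕ → ℤ) → List ℕ → ℤ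
pascalSum f []       = 0ℤ
pascalSum f (k ∷ ks) = atPred k (λ k′ → f (k′ ∷ ks)) + pascalSum (λ ks′ → f (k ∷ ks′)) ks

pascalSum-scale : ∀ ks c {f g : List ℕ → ℤ} →
  (∀ ks′ → suc (sum ks′) ≡ sum ks → f ks′ ≡ c * g ks′) → pascalSum f ks ≡ c * pascalSum g ks
pascalSum-scale []       c h = sym (ℤ.*-zeroʳ c)
pascalSum-scale (k ∷ ks) c {f} {g} h = begin
  atPred k (λ k′ → f (k′ ∷ ks)) + pascalSum (λ ks′ → f (k ∷ ks′)) ks
    ≡⟨ cong₂ _+_ (trans (atPred-cong k λ m e → h (m ∷ ks) (cong (ℕ._+ sum ks) e)) (atSub-* 1 k c _))
                 (pascalSum-scale ks c λ ks′ e → h (k ∷ ks′) (trans (sym (ℕ.+-suc k _)) (cong (k ℕ.+_) e))) ⟩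
  c * atPred k (λ k′ → g (k′ ∷ ks)) + c * pascalSum (λ ks′ → g (k ∷ ks′)) ks
    ≡⟨ ℤ.*-distribˡ-+ c _ _ ⟨
  c * pascalSum g (k ∷ ks) ∎

pascalSum-vanishes : ∀ ks (f : List ℕ → ℤ) → sum ks ≡ 0 → pascalSum f ks ≡ 0ℤ
pascalSum-vanishes ks f e =
  trans (pascalSum-scale ks 0ℤ {g = f} λ ks′ e′ → contradiction (trans e′ e) λ ()) (ℤ.*-zeroˡ (pascalSum f ks))

binomial-pascal : ∀ k s → (suc k ℕ.+ suc s) C suc k ≡ (k ℕ.+ suc s) C k ℕ.+ (suc k ℕ.+ s) C suc k
binomial-pascal k s rewrite ℕ.+-suc k s = sym (nCk+nC[k+1]≡[n+1]C[k+1] (suc (k ℕ.+ s)) k)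

multinomial-pascal : ∀ ks {t} → sum ks ≡ suc t → + multinomial ks ≡ pascalSum (λ ks′ → + multinomial ks′) ks
multinomial-pascal (k ∷ ks) e with sum ks in s
multinomial-pascal (zero ∷ ks)  () | zero
multinomial-pascal (suc k ∷ ks) e  | zero
  rewrite ℕ.+-identityʳ k | nCn≡1 (suc k) | nCn≡1 k | pascalSum-vanishes ks (λ ks′ → + multinomial (suc k ∷ ks′)) s
  = sym (ℤ.+-identityʳ _)
multinomial-pascal (k ∷ ks) e | suc s′ = begin
  + (((k ℕ.+ suc s′) C k) ℕ.* M)                      ≡⟨ head k ⟩
  H + c * + M                                         ≡⟨ cong (λ z → H + c * z) (multinomial-pascal ks s) ⟩
  H + c * pascalSum (λ ks′ → + multinomial ks′) ks    ≡⟨ +-congˡ {H} (pascalSum-scale ks c tail) ⟨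
  H + pascalSum (λ ks′ → + multinomial (k ∷ ks′)) ks  ∎
  where
  M = multinomial ks
  c = + ((k ℕ.+ s′) C k)
  H = atPred k (λ k′ → + (((k′ ℕ.+ suc s′) C k′) ℕ.* M))
  pos-split : ∀ {a} b c → a ≡ b ℕ.+ c → + (a ℕ.* M) ≡ + (b ℕ.* M) + + c * + M
  pos-split b c refl =
    trans (cong +_ (ℕ.*-distribʳ-+ M b c)) (trans (ℤ.pos-+ (b ℕ.* M) (c ℕ.* M)) (+-congˡ {+ (b ℕ.* M)} (ℤ.pos-* c M)))
  head : ∀ k → + (((k ℕ.+ suc s′) C k) ℕ.* M)
             ≡ atPred k (λ k′ → + (((k′ ℕ.+ suc s′) C k′) ℕ.* M)) + + ((k ℕ.+ s′) C k) * + M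
  head zero    = trans (ℤ.pos-* (suc s′ C 0) M) (sym (ℤ.+-identityˡ _))
  head (suc k) = pos-split ((k ℕ.+ suc s′) C k) ((suc k ℕ.+ s′) C suc k) (binomial-pascal k s′)
  tail : ∀ ks′ → suc (sum ks′) ≡ sum ks → + multinomial (k ∷ ks′) ≡ c * + multinomial ks′
  tail ks′ e′ rewrite ℕ.suc-injective (trans e′ s) = ℤ.pos-* ((k ℕ.+ s′) C k) (multinomial ks′)

sumTo-cong : ∀ K {f g : ℕ → ℤ} → (∀ i → f i ≡ g i) → sumTo K f ≡ sumTo K g
sumTo-cong zero    h = h 0
sumTo-cong (suc K) h = cong₂ _+_ (sumTo-cong K h) (h (suc K))

sumTo-zero : ∀ K {f : ℕ → ℤ} → (∀ i → i ℕ.≤ K → f i ≡ 0ℤ) → sumTo K f ≡ 0ℤ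
sumTo-zero zero    h = h 0 ℕ.z≤n
sumTo-zero (suc K) h = cong₂ _+_ (sumTo-zero K λ i le → h i (ℕ.m≤n⇒m≤1+n le)) (h (suc K) ℕ.≤-refl)

sumTo-+ : ∀ K (f g : ℕ → ℤ) → sumTo K (λ i → f i + g i) ≡ sumTo K f + sumTo K g
sumTo-+ zero    f g = refl
sumTo-+ (suc K) f g =
  trans (+-congʳ (sumTo-+ K f g)) (+-interchange (sumTo K f) (sumTo K g) (f (suc K)) (g (suc K)))

sumTo-* : ∀ K c (f : ℕ → ℤ) → sumTo K (λ i → c * f i) ≡ c * sumTo K f
sumTo-* zero    c f = refl
sumTo-* (suc K) c f = trans (+-congʳ (sumTo-* K c f)) (sym (ℤ.*-distribˡ-+ c (sumTo K f) (f (suc K))))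

sumTo-extend : ∀ {m K} (f : ℕ → ℤ) → m ℕ.≤ K → (∀ i → m ℕ.< i → f i ≡ 0ℤ) → sumTo K f ≡ sumTo m f
sumTo-extend {m} {K} f m≤K h with ℕ.m≤n⇒m<n∨m≡n m≤K
... | inj₂ refl = refl
sumTo-extend {m} {suc K} f _ h | inj₁ (ℕ.s≤s m≤K) =
  trans (+-congˡ {sumTo K f} (h (suc K) (ℕ.s≤s m≤K))) (trans (ℤ.+-identityʳ _) (sumTo-extend f m≤K h))

sumTo-atPred : ∀ K (f : ℕ → ℤ) → sumTo K (λ i → atPred i f) ≡ atPred K (λ m → sumTo m f)
sumTo-atPred zero          f = refl
sumTo-atPred (suc zero)    f = ℤ.+-identityˡ (f 0)
sumTo-atPred (suc (suc K)) f = +-congʳ (sumTo-atPred (suc K) f)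

sumTo-atSub : ∀ K k n (g : ℕ → ℕ → ℤ) → sumTo K (λ i → atSub k n (g i)) ≡ atSub k n (λ a → sumTo K (λ i → g i a))
sumTo-atSub K = atSub-commutes (sumTo K) (sumTo-zero K λ _ _ → refl)

sumTo-δ : ∀ N {m} (g : ℕ → ℤ) → m ℕ.≤ N → sumTo N (λ r → if does (m ℕ.≟ r) then g r else 0ℤ) ≡ g m
sumTo-δ N {m} g m≤N with ℕ.m≤n⇒m<n∨m≡n m≤N
sumTo-δ (suc N) g _ | inj₁ (ℕ.s≤s m≤N) rewrite dec-false (_ ℕ.≟ suc N) (ℕ.<⇒≢ (ℕ.s≤s m≤N)) =
  trans (ℤ.+-identityʳ _) (sumTo-δ N g m≤N)
sumTo-δ zero {m} g _ | inj₂ refl rewrite dec-true (m ℕ.≟ m) refl = refl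
sumTo-δ (suc N) g _ | inj₂ refl rewrite dec-true (suc N ℕ.≟ suc N) refl =
  trans (+-congʳ (sumTo-zero N λ r r≤N → cong (if_then g r else 0ℤ) (dec-false (suc N ℕ.≟ r) λ { refl → ℕ.<-irrefl refl r≤N })))
        (ℤ.+-identityˡ _)

sumOver : {A : Set} → List A → (A → ℤ) → ℤ
sumOver []       f = 0ℤ
sumOver (a ∷ as) f = f a + sumOver as f

private variable
  A B : Set

sumOver-cong : ∀ (as : List A) {f g : A → ℤ} → (∀ a → f a ≡ g a) → sumOver as f ≡ sumOver as g
sumOver-cong []       h = refl
sumOver-cong (a ∷ as) h = cong₂ _+_ (h a) (sumOver-cong as h)

sumOver-zero : ∀ (as : List A) → sumOver as (λ _ → 0ℤ) ≡ 0ℤ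
sumOver-zero []       = refl
sumOver-zero (a ∷ as) = trans (ℤ.+-identityˡ _) (sumOver-zero as)

sumOver-+ : ∀ (as : List A) (f g : A → ℤ) → sumOver as (λ a → f a + g a) ≡ sumOver as f + sumOver as g
sumOver-+ []       f g = refl
sumOver-+ (a ∷ as) f g = trans (+-congˡ {f a + g a} (sumOver-+ as f g)) (+-interchange (f a) (g a) (sumOver as f) (sumOver as g))

sumOver-* : ∀ (as : List A) c (f : A → ℤ) → sumOver as (λ a → c * f a) ≡ c * sumOver as f
sumOver-* []       c f = sym (ℤ.*-zeroʳ c)
sumOver-* (a ∷ as) c f = trans (+-congˡ {c * f a} (sumOver-* as c f)) (sym (ℤ.*-distribˡ-+ c (f a) (sumOver as f)))

sumOver-++ : ∀ (as bs : List A) (f : A → ℤ) → sumOver (as ++ bs) f ≡ sumOver as f + sumOver bs f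
sumOver-++ []       bs f = sym (ℤ.+-identityˡ _)
sumOver-++ (a ∷ as) bs f = trans (+-congˡ {f a} (sumOver-++ as bs f)) (sym (ℤ.+-assoc (f a) _ _))

sumOver-swap : (as : List A) (bs : List B) (f : A → B → ℤ) →
  sumOver as (λ a → sumOver bs (f a)) ≡ sumOver bs (λ b → sumOver as (λ a → f a b))
sumOver-swap []       bs f = sym (sumOver-zero bs)
sumOver-swap (a ∷ as) bs f = trans (+-congˡ {sumOver bs (f a)} (sumOver-swap as bs f)) (sym (sumOver-+ bs (f a) _))

sumOver-concatMap : (g : A → List B) (as : List A) (f : B → ℤ) →
  sumOver (concatMap g as) f ≡ sumOver as (λ a → sumOver (g a) f)
sumOver-concatMap g []       f = refl
sumOver-concatMap g (a ∷ as) f = trans (sumOver-++ (g a) (concatMap g as) f) (+-congˡ {sumOver (g a) f} (sumOver-concatMap g as f))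

sumOver-map : (g : B → A) (bs : List B) (f : A → ℤ) → sumOver (map g bs) f ≡ sumOver bs (λ b → f (g b))
sumOver-map g []       f = refl
sumOver-map g (b ∷ bs) f = +-congˡ {f (g b)} (sumOver-map g bs f)

sumOver-filter : ∀ {P : A → Set} (P? : Decidable P) (as : List A) (f : A → ℤ) →
  sumOver (filter P? as) f ≡ sumOver as (λ a → if does (P? a) then f a else 0ℤ)
sumOver-filter P? []       f = refl
sumOver-filter P? (a ∷ as) f with does (P? a)
... | true  = +-congˡ {f a} (sumOver-filter P? as f)
... | false = trans (sumOver-filter P? as f) (sym (ℤ.+-identityˡ _))

sumTo-levels : ∀ N (h : A → ℕ) (g : ℕ → ℤ) (as : List A) → All (λ a → h a ℕ.≤ N) as →
  sumTo N (λ r → + length (filter (λ a → h a ℕ.≟ r) as) * g r) ≡ sumOver as (λ a → g (h a))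
sumTo-levels N h g []       []       = sumTo-zero N λ r _ → ℤ.*-zeroˡ (g r)
sumTo-levels N h g (a ∷ as) (p ∷ ps) = begin
  sumTo N (λ r → + level (a ∷ as) r * g r)                        ≡⟨ sumTo-cong N split ⟩
  sumTo N (λ r → δ r + + level as r * g r)                        ≡⟨ sumTo-+ N δ _ ⟩
  sumTo N δ + sumTo N (λ r → + level as r * g r)                  ≡⟨ cong₂ _+_ (sumTo-δ N g p) (sumTo-levels N h g as ps) ⟩
  g (h a) + sumOver as (λ a → g (h a))                            ∎
  where
  level : List _ → ℕ → ℕ
  level as r = length (filter (λ a → h a ℕ.≟ r) as)
  δ : ℕ → ℤ
  δ r = if does (h a ℕ.≟ r) then g r else 0ℤ
  split : ∀ r → + level (a ∷ as) r * g r ≡ δ r + + level as r * g r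
  split r with does (h a ℕ.≟ r)
  ... | true  = trans (cong (_* g r) (ℤ.pos-+ 1 (level as r)))
                      (trans (ℤ.*-distribʳ-+ (g r) (+ 1) (+ level as r)) (+-congʳ (ℤ.*-identityˡ (g r))))
  ... | false = sym (ℤ.+-identityˡ _)

-- A grid function stands for a function on ℤ³ vanishing off ℕ³, and shift k F for its translate F (· − k).
Grid : Set
Grid = ℕ → ℕ → ℕ → ℤ

shift : ℕ → ℕ → ℕ → Grid → Grid
shift k₁ k₂ k₃ F n₁ n₂ n₃ = atSub k₁ n₁ λ a → atSub k₂ n₂ λ b → atSub k₃ n₃ λ c → F a b c

Σbox : ℕ → ℕ → ℕ → Grid → ℤ
Σbox K₁ K₂ K₃ F = sumTo K₁ λ i → sumTo K₂ λ j → sumTo K₃ λ l → F i j l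

module _ (k₁ k₂ k₃ n₁ n₂ n₃ : ℕ) where

  shift-cong : ∀ {F G : Grid} →
    (∀ a b c → k₁ ℕ.+ a ≡ n₁ → k₂ ℕ.+ b ≡ n₂ → k₃ ℕ.+ c ≡ n₃ → F a b c ≡ G a b c) →
    shift k₁ k₂ k₃ F n₁ n₂ n₃ ≡ shift k₁ k₂ k₃ G n₁ n₂ n₃
  shift-cong h = atSub-cong k₁ n₁ λ a e₁ → atSub-cong k₂ n₂ λ b e₂ → atSub-cong k₃ n₃ λ c e₃ → h a b c e₁ e₂ e₃

  shift-+ : ∀ (F G : Grid) →
    shift k₁ k₂ k₃ (λ a b c → F a b c + G a b c) n₁ n₂ n₃ ≡ shift k₁ k₂ k₃ F n₁ n₂ n₃ + shift k₁ k₂ k₃ G n₁ n₂ n₃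
  shift-+ F G =
    trans (atSub-cong k₁ n₁ λ a _ → trans (atSub-cong k₂ n₂ λ b _ → atSub-+ k₃ n₃ (F a b) (G a b)) (atSub-+ k₂ n₂ _ _))
          (atSub-+ k₁ n₁ _ _)

  shift-* : ∀ c (F : Grid) → shift k₁ k₂ k₃ (λ a b d → c * F a b d) n₁ n₂ n₃ ≡ c * shift k₁ k₂ k₃ F n₁ n₂ n₃
  shift-* c F =
    trans (atSub-cong k₁ n₁ λ a _ → trans (atSub-cong k₂ n₂ λ b _ → atSub-* k₃ n₃ c (F a b)) (atSub-* k₂ n₂ c _))
          (atSub-* k₁ n₁ c _)

  shift-zero : shift k₁ k₂ k₃ (λ _ _ _ → 0ℤ) n₁ n₂ n₃ ≡ 0ℤ
  shift-zero =
    trans (atSub-cong k₁ n₁ λ a _ → trans (atSub-cong k₂ n₂ λ b _ → atSub-zero k₃ n₃) (atSub-zero k₂ n₂)) (atSub-zero k₁ n₁)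

  shift-commutes : ∀ {I : Set} (L : (I → ℤ) → ℤ) → L (λ _ → 0ℤ) ≡ 0ℤ → ∀ (G : I → Grid) →
    L (λ i → shift k₁ k₂ k₃ (G i) n₁ n₂ n₃) ≡ shift k₁ k₂ k₃ (λ a b c → L (λ i → G i a b c)) n₁ n₂ n₃
  shift-commutes L L-zero G =
    trans (atSub-commutes L L-zero k₁ n₁ _) (atSub-cong k₁ n₁ λ a _ →
    trans (atSub-commutes L L-zero k₂ n₂ _) (atSub-cong k₂ n₂ λ b _ → atSub-commutes L L-zero k₃ n₃ _))

shift-shift : ∀ k₁ k₂ k₃ k₁′ k₂′ k₃′ (F : Grid) n₁ n₂ n₃ →
  shift k₁ k₂ k₃ (shift k₁′ k₂′ k₃′ F) n₁ n₂ n₃ ≡ shift (k₁ ℕ.+ k₁′) (k₂ ℕ.+ k₂′) (k₃ ℕ.+ k₃′) F n₁ n₂ n₃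
shift-shift k₁ k₂ k₃ k₁′ k₂′ k₃′ F n₁ n₂ n₃ =
  trans (atSub-cong k₁ n₁ λ a _ → trans (atSub-cong k₂ n₂ λ b _ → inner a b) (middle a)) (atSub-atSub k₁ k₁′ n₁ _)
  where
  inner : ∀ a b → atSub k₃ n₃ (λ c → shift k₁′ k₂′ k₃′ F a b c)
                ≡ atSub k₁′ a λ a′ → atSub k₂′ b λ b′ → atSub (k₃ ℕ.+ k₃′) n₃ (F a′ b′)
  inner a b =
    trans (atSub-comm k₃ n₃ k₁′ a _) (atSub-cong k₁′ a λ a′ _ →
    trans (atSub-comm k₃ n₃ k₂′ b _) (atSub-cong k₂′ b λ b′ _ → atSub-atSub k₃ k₃′ n₃ (F a′ b′)))
  middle : ∀ a → atSub k₂ n₂ (λ b → atSub k₁′ a λ a′ → atSub k₂′ b λ b′ → atSub (k₃ ℕ.+ k₃′) n₃ (F a′ b′))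
               ≡ atSub k₁′ a λ a′ → atSub (k₂ ℕ.+ k₂′) n₂ λ b′ → atSub (k₃ ℕ.+ k₃′) n₃ (F a′ b′)
  middle a = trans (atSub-comm k₂ n₂ k₁′ a _) (atSub-cong k₁′ a λ a′ _ → atSub-atSub k₂ k₂′ n₂ _)

module _ (K₁ K₂ K₃ : ℕ) where

  Σbox-cong : ∀ {F G : Grid} → (∀ i j l → F i j l ≡ G i j l) → Σbox K₁ K₂ K₃ F ≡ Σbox K₁ K₂ K₃ G
  Σbox-cong h = sumTo-cong K₁ λ i → sumTo-cong K₂ λ j → sumTo-cong K₃ λ l → h i j l

  Σbox-+ : ∀ (F G : Grid) → Σbox K₁ K₂ K₃ (λ i j l → F i j l + G i j l) ≡ Σbox K₁ K₂ K₃ F + Σbox K₁ K₂ K₃ G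
  Σbox-+ F G =
    trans (sumTo-cong K₁ λ i → trans (sumTo-cong K₂ λ j → sumTo-+ K₃ (F i j) (G i j)) (sumTo-+ K₂ _ _)) (sumTo-+ K₁ _ _)

  Σbox-* : ∀ c (F : Grid) → Σbox K₁ K₂ K₃ (λ i j l → c * F i j l) ≡ c * Σbox K₁ K₂ K₃ F
  Σbox-* c F =
    trans (sumTo-cong K₁ λ i → trans (sumTo-cong K₂ λ j → sumTo-* K₃ c (F i j)) (sumTo-* K₂ c _)) (sumTo-* K₁ c _)

  Σbox-shift : ∀ k₁ k₂ k₃ n₁ n₂ n₃ (G : ℕ → ℕ → ℕ → Grid) →
    Σbox K₁ K₂ K₃ (λ i j l → shift k₁ k₂ k₃ (G i j l) n₁ n₂ n₃)
      ≡ shift k₁ k₂ k₃ (λ a b c → Σbox K₁ K₂ K₃ (λ i j l → G i j l a b c)) n₁ n₂ n₃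
  Σbox-shift k₁ k₂ k₃ n₁ n₂ n₃ G =
    trans (sumTo-cong K₁ λ i → trans (sumTo-cong K₂ λ j → commute K₃ (G i j)) (commute K₂ _)) (commute K₁ _)
    where
    commute : ∀ K (H : ℕ → Grid) → sumTo K (λ i → shift k₁ k₂ k₃ (H i) n₁ n₂ n₃)
                                  ≡ shift k₁ k₂ k₃ (λ a b c → sumTo K (λ i → H i a b c)) n₁ n₂ n₃
    commute K = shift-commutes k₁ k₂ k₃ n₁ n₂ n₃ (sumTo K) (sumTo-zero K λ _ _ → refl)

  Σbox-atPred₁ : ∀ (F : Grid) →
    Σbox K₁ K₂ K₃ (λ i j l → atPred i (λ i′ → F i′ j l)) ≡ atPred K₁ (λ m → Σbox m K₂ K₃ F)
  Σbox-atPred₁ F =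
    trans (sumTo-cong K₁ λ i → trans (sumTo-cong K₂ λ j → sumTo-atSub K₃ 1 i _) (sumTo-atSub K₂ 1 i _)) (sumTo-atPred K₁ _)

  Σbox-atPred₂ : ∀ (F : Grid) →
    Σbox K₁ K₂ K₃ (λ i j l → atPred j (λ j′ → F i j′ l)) ≡ atPred K₂ (λ m → Σbox K₁ m K₃ F)
  Σbox-atPred₂ F =
    trans (sumTo-cong K₁ λ i → trans (sumTo-cong K₂ λ j → sumTo-atSub K₃ 1 j _) (sumTo-atPred K₂ _)) (sumTo-atSub K₁ 1 K₂ _)

  Σbox-atPred₃ : ∀ (F : Grid) →
    Σbox K₁ K₂ K₃ (λ i j l → atPred l (λ l′ → F i j l′)) ≡ atPred K₃ (λ m → Σbox K₁ K₂ m F)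
  Σbox-atPred₃ F =
    trans (sumTo-cong K₁ λ i → trans (sumTo-cong K₂ λ j → sumTo-atPred K₃ _) (sumTo-atSub K₂ 1 K₃ _)) (sumTo-atSub K₁ 1 K₃ _)

Σbox-extend : ∀ {n₁ n₂ n₃ K₁ K₂ K₃} (F : Grid) → n₁ ℕ.≤ K₁ → n₂ ℕ.≤ K₂ → n₃ ℕ.≤ K₃ →
  (∀ i j l → n₁ ℕ.< i → F i j l ≡ 0ℤ) → (∀ i j l → n₂ ℕ.< j → F i j l ≡ 0ℤ) → (∀ i j l → n₃ ℕ.< l → F i j l ≡ 0ℤ) →
  Σbox K₁ K₂ K₃ F ≡ Σbox n₁ n₂ n₃ F
Σbox-extend {n₁} {n₂} {n₃} {K₁} {K₂} {K₃} F le₁ le₂ le₃ h₁ h₂ h₃ =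
  trans (sumTo-cong K₁ λ i → sumTo-cong K₂ λ j → sumTo-extend _ le₃ (h₃ i j))
 (trans (sumTo-cong K₁ λ i → sumTo-extend _ le₂ λ j n₂<j → sumTo-zero n₃ λ l _ → h₂ i j l n₂<j)
        (sumTo-extend _ le₁ λ i n₁<i → sumTo-zero n₂ λ j _ → sumTo-zero n₃ λ l _ → h₁ i j l n₁<i))

shift-vanishes : ∀ k₁ k₂ k₃ n₁ n₂ n₃ {F : Grid} →
  (∀ a b c → k₁ ℕ.+ a ≡ n₁ → k₂ ℕ.+ b ≡ n₂ → k₃ ℕ.+ c ≡ n₃ → ⊥) → shift k₁ k₂ k₃ F n₁ n₂ n₃ ≡ 0ℤ
shift-vanishes k₁ k₂ k₃ n₁ n₂ n₃ h =
  trans (shift-cong k₁ k₂ k₃ n₁ n₂ n₃ λ a b c e₁ e₂ e₃ → ⊥-elim (h a b c e₁ e₂ e₃)) (shift-zero k₁ k₂ k₃ n₁ n₂ n₃)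

<⇒+≢ : ∀ {k n a} → n ℕ.< k → k ℕ.+ a ≢ n
<⇒+≢ {k} {a = a} n<k refl = ℕ.<⇒≱ n<k (ℕ.m≤m+n k a)

shift-index : ∀ {k₁ k₂ k₃ k₁′ k₂′ k₃′} → k₁ ≡ k₁′ → k₂ ≡ k₂′ → k₃ ≡ k₃′ →
  ∀ F n₁ n₂ n₃ → shift k₁ k₂ k₃ F n₁ n₂ n₃ ≡ shift k₁′ k₂′ k₃′ F n₁ n₂ n₃
shift-index refl refl refl F n₁ n₂ n₃ = refl

shift-shift-comm : ∀ k₁ k₂ k₃ k₁′ k₂′ k₃′ (F : Grid) n₁ n₂ n₃ →
  shift k₁ k₂ k₃ (shift k₁′ k₂′ k₃′ F) n₁ n₂ n₃ ≡ shift k₁′ k₂′ k₃′ (shift k₁ k₂ k₃ F) n₁ n₂ n₃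
shift-shift-comm k₁ k₂ k₃ k₁′ k₂′ k₃′ F n₁ n₂ n₃ =
  trans (shift-shift k₁ k₂ k₃ k₁′ k₂′ k₃′ F n₁ n₂ n₃)
 (trans (shift-index (ℕ.+-comm k₁ k₁′) (ℕ.+-comm k₂ k₂′) (ℕ.+-comm k₃ k₃′) F n₁ n₂ n₃)
        (sym (shift-shift k₁′ k₂′ k₃′ k₁ k₂ k₃ F n₁ n₂ n₃)))

+-interchange₃ : ∀ k₁ k₂ k₃ a b c → (k₁ ℕ.+ k₂ ℕ.+ k₃) ℕ.+ (a ℕ.+ b ℕ.+ c) ≡ (k₁ ℕ.+ a) ℕ.+ (k₂ ℕ.+ b) ℕ.+ (k₃ ℕ.+ c)
+-interchange₃ = ℕ-Ring.solve-∀

shift-affine : ∀ k₁ k₂ k₃ k₁′ k₂′ k₃′ n₁ n₂ n₃ y {G F H : Grid} →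
  (∀ a b c → G a b c ≡ F a b c + y * shift k₁′ k₂′ k₃′ H a b c) →
  shift k₁ k₂ k₃ G n₁ n₂ n₃ ≡ shift k₁ k₂ k₃ F n₁ n₂ n₃ + y * shift (k₁ ℕ.+ k₁′) (k₂ ℕ.+ k₂′) (k₃ ℕ.+ k₃′) H n₁ n₂ n₃
shift-affine k₁ k₂ k₃ k₁′ k₂′ k₃′ n₁ n₂ n₃ y {F = F} {H} h =
  trans (shift-cong k₁ k₂ k₃ n₁ n₂ n₃ λ a b c _ _ _ → h a b c)
 (trans (shift-+ k₁ k₂ k₃ n₁ n₂ n₃ F _)
        (cong (λ z → shift k₁ k₂ k₃ F n₁ n₂ n₃ + z)
              (trans (shift-* k₁ k₂ k₃ n₁ n₂ n₃ y _) (cong (y *_) (shift-shift k₁ k₂ k₃ k₁′ k₂′ k₃′ H n₁ n₂ n₃)))))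

-- The tile recurrence

-- The six steps e₁, e₂, e₃, e₁+e₂, e₂+e₃, e₁+e₂+e₃ of the recurrence, with weights 1, 1, 1, x, x, x².
tiles : ℤ → ℤ → ℤ → ℤ → ℤ → ℤ → ℤ → ℤ
tiles x p₁ p₂ p₃ p₁₂ p₂₃ p₁₂₃ = p₁ + p₂ + p₃ + x * p₁₂ + x * p₂₃ + x * x * p₁₂₃

tiles-cong : ∀ x {p₁ p₂ p₃ p₄ p₅ p₆ q₁ q₂ q₃ q₄ q₅ q₆} →
  p₁ ≡ q₁ → p₂ ≡ q₂ → p₃ ≡ q₃ → p₄ ≡ q₄ → p₅ ≡ q₅ → p₆ ≡ q₆ → tiles x p₁ p₂ p₃ p₄ p₅ p₆ ≡ tiles x q₁ q₂ q₃ q₄ q₅ q₆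
tiles-cong x refl refl refl refl refl refl = refl

module _ (L : Grid → ℤ)
         (L-+ : ∀ F G → L (λ a b c → F a b c + G a b c) ≡ L F + L G)
         (L-* : ∀ y F → L (λ a b c → y * F a b c) ≡ y * L F) where

  tiles-linear : ∀ x (F₁ F₂ F₃ F₁₂ F₂₃ F₁₂₃ : Grid) →
    L (λ a b c → tiles x (F₁ a b c) (F₂ a b c) (F₃ a b c) (F₁₂ a b c) (F₂₃ a b c) (F₁₂₃ a b c))
      ≡ tiles x (L F₁) (L F₂) (L F₃) (L F₁₂) (L F₂₃) (L F₁₂₃)
  tiles-linear x F₁ F₂ F₃ F₁₂ F₂₃ F₁₂₃ =
    trans (L-+ _ _) (cong₂ _+_ (trans (L-+ _ _) (cong₂ _+_ (trans (L-+ _ _) (cong₂ _+_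
      (trans (L-+ _ _) (cong₂ _+_ (L-+ F₁ F₂) refl)) (L-* x F₁₂))) (L-* x F₂₃))) (L-* (x * x) F₁₂₃))

module _ (x : ℤ) where

  tileStep : Grid → Grid
  tileStep f n₁ n₂ n₃ =
    tiles x (shift 1 0 0 f n₁ n₂ n₃) (shift 0 1 0 f n₁ n₂ n₃) (shift 0 0 1 f n₁ n₂ n₃)
            (shift 1 1 0 f n₁ n₂ n₃) (shift 0 1 1 f n₁ n₂ n₃) (shift 1 1 1 f n₁ n₂ n₃)

  TileRecurrence : Grid → Set
  TileRecurrence f = ∀ n₁ n₂ n₃ t → n₁ ℕ.+ n₂ ℕ.+ n₃ ≡ suc t → f n₁ n₂ n₃ ≡ tileStep f n₁ n₂ n₃

  private
    total : ℕ → ℕ → ℕ → ℕ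
    total a b c = a ℕ.+ b ℕ.+ c

    shift-cong-below : ∀ k₁ k₂ k₃ n₁ n₂ n₃ {F G : Grid} → 0 ℕ.< total k₁ k₂ k₃ →
      (∀ a b c → total a b c ℕ.< total n₁ n₂ n₃ → F a b c ≡ G a b c) →
      shift k₁ k₂ k₃ F n₁ n₂ n₃ ≡ shift k₁ k₂ k₃ G n₁ n₂ n₃
    shift-cong-below k₁ k₂ k₃ n₁ n₂ n₃ pos h = shift-cong k₁ k₂ k₃ n₁ n₂ n₃ λ where
      a b c refl refl refl → h a b c (subst (total a b c ℕ.<_) (+-interchange₃ k₁ k₂ k₃ a b c) (ℕ.+-monoˡ-< (total a b c) pos))

  tileStep-cong : ∀ n₁ n₂ n₃ {f g : Grid} →
    (∀ a b c → a ℕ.+ b ℕ.+ c ℕ.< n₁ ℕ.+ n₂ ℕ.+ n₃ → f a b c ≡ g a b c) → tileStep f n₁ n₂ n₃ ≡ tileStep g n₁ n₂ n₃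
  tileStep-cong n₁ n₂ n₃ h =
    cong₂ _+_ (cong₂ _+_ (cong₂ _+_ (cong₂ _+_ (cong₂ _+_
      (shift-cong-below 1 0 0 n₁ n₂ n₃ pos h) (shift-cong-below 0 1 0 n₁ n₂ n₃ pos h)) (shift-cong-below 0 0 1 n₁ n₂ n₃ pos h))
      (cong (x *_) (shift-cong-below 1 1 0 n₁ n₂ n₃ pos h))) (cong (x *_) (shift-cong-below 0 1 1 n₁ n₂ n₃ pos h)))
      (cong (x * x *_) (shift-cong-below 1 1 1 n₁ n₂ n₃ pos h))
    where
    pos : ∀ {m} → 0 ℕ.< suc m
    pos = ℕ.s≤s ℕ.z≤n

  tileRecurrence-unique : ∀ {f g : Grid} → TileRecurrence f → TileRecurrence g → f 0 0 0 ≡ g 0 0 0 →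
    ∀ n₁ n₂ n₃ → f n₁ n₂ n₃ ≡ g n₁ n₂ n₃
  tileRecurrence-unique {f} {g} rec-f rec-g origin n₁ n₂ n₃ = <-rec P step (n₁ ℕ.+ n₂ ℕ.+ n₃) n₁ n₂ n₃ refl
    where
    P : ℕ → Set
    P k = ∀ n₁ n₂ n₃ → n₁ ℕ.+ n₂ ℕ.+ n₃ ≡ k → f n₁ n₂ n₃ ≡ g n₁ n₂ n₃
    step : ∀ k → (∀ {k′} → k′ ℕ.< k → P k′) → P k
    step zero    _  zero zero zero _ = origin
    step (suc t) IH n₁   n₂   n₃   e =
      trans (rec-f n₁ n₂ n₃ t e)
     (trans (tileStep-cong n₁ n₂ n₃ λ a b c lt → IH (subst (a ℕ.+ b ℕ.+ c ℕ.<_) e lt) a b c refl)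
            (sym (rec-g n₁ n₂ n₃ t e)))

-- For φ i j l a b c = multinomial (i, j, l, a, b, c) · x ^ (i + j + 2 l), boxSum is the
-- right-hand side of the corollary, a, b, c being the parts n₁ − i − l, n₂ − i − j − l, n₃ − j − l.
module BoxSum (x : ℤ) (φ : ℕ → ℕ → ℕ → Grid) where

  term : ℕ → ℕ → ℕ → Grid
  term i j l = shift (i ℕ.+ l) (i ℕ.+ j ℕ.+ l) (j ℕ.+ l) (φ i j l)

  boxSum : Grid
  boxSum n₁ n₂ n₃ = Σbox n₁ n₂ n₃ (λ i j l → term i j l n₁ n₂ n₃)

  Pascal₆ : Set
  Pascal₆ = ∀ i j l a b c t → i ℕ.+ j ℕ.+ l ℕ.+ a ℕ.+ b ℕ.+ c ≡ suc t →
    φ i j l a b c ≡ tiles x (shift 1 0 0 (φ i j l) a b c) (shift 0 1 0 (φ i j l) a b c) (shift 0 0 1 (φ i j l) a b c)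
                           (atPred i λ i′ → φ i′ j l a b c) (atPred j λ j′ → φ i j′ l a b c) (atPred l λ l′ → φ i j l′ a b c)

  boxSum-extend : ∀ {K₁ K₂ K₃} n₁ n₂ n₃ → n₁ ℕ.≤ K₁ → n₂ ℕ.≤ K₂ → n₃ ℕ.≤ K₃ →
    Σbox K₁ K₂ K₃ (λ i j l → term i j l n₁ n₂ n₃) ≡ boxSum n₁ n₂ n₃
  boxSum-extend n₁ n₂ n₃ le₁ le₂ le₃ = Σbox-extend _ le₁ le₂ le₃
    (λ i j l lt → vanish i j l λ _ _ _ e _ _ → <⇒+≢ (ℕ.<-≤-trans lt (ℕ.m≤m+n i l)) e)
    (λ i j l lt → vanish i j l λ _ _ _ _ e _ → <⇒+≢ (ℕ.<-≤-trans lt (ℕ.≤-trans (ℕ.m≤n+m j i) (ℕ.m≤m+n (i ℕ.+ j) l))) e)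
    (λ i j l lt → vanish i j l λ _ _ _ _ _ e → <⇒+≢ (ℕ.<-≤-trans lt (ℕ.m≤n+m l j)) e)
    where
    vanish : ∀ i j l → (∀ a b c → i ℕ.+ l ℕ.+ a ≡ n₁ → i ℕ.+ j ℕ.+ l ℕ.+ b ≡ n₂ → j ℕ.+ l ℕ.+ c ≡ n₃ → ⊥) →
      term i j l n₁ n₂ n₃ ≡ 0ℤ
    vanish i j l = shift-vanishes (i ℕ.+ l) (i ℕ.+ j ℕ.+ l) (j ℕ.+ l) n₁ n₂ n₃

  Σbox-shift-term : ∀ K₁ K₂ K₃ k₁ k₂ k₃ n₁ n₂ n₃ → n₁ ℕ.≤ k₁ ℕ.+ K₁ → n₂ ℕ.≤ k₂ ℕ.+ K₂ → n₃ ℕ.≤ k₃ ℕ.+ K₃ →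
    Σbox K₁ K₂ K₃ (λ i j l → shift k₁ k₂ k₃ (term i j l) n₁ n₂ n₃) ≡ shift k₁ k₂ k₃ boxSum n₁ n₂ n₃
  Σbox-shift-term K₁ K₂ K₃ k₁ k₂ k₃ n₁ n₂ n₃ le₁ le₂ le₃ =
    trans (Σbox-shift K₁ K₂ K₃ k₁ k₂ k₃ n₁ n₂ n₃ term) (shift-cong k₁ k₂ k₃ n₁ n₂ n₃ λ a b c e₁ e₂ e₃ →
      boxSum-extend a b c (below e₁ le₁) (below e₂ le₂) (below e₃ le₃))
    where
    below : ∀ {k a n K} → k ℕ.+ a ≡ n → n ℕ.≤ k ℕ.+ K → a ℕ.≤ K
    below {k} refl le = ℕ.+-cancelˡ-≤ k _ _ le

  private
    parts-nonzero : ∀ i j l a b c {t} → (i ℕ.+ l ℕ.+ a) ℕ.+ (i ℕ.+ j ℕ.+ l ℕ.+ b) ℕ.+ (j ℕ.+ l ℕ.+ c) ≡ suc t →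
      ∃[ t′ ] i ℕ.+ j ℕ.+ l ℕ.+ a ℕ.+ b ℕ.+ c ≡ suc t′
    parts-nonzero (suc i) j l a b c _ = _ , refl
    parts-nonzero 0 (suc j) l a b c _ = _ , refl
    parts-nonzero 0 0 (suc l) a b c _ = _ , refl
    parts-nonzero 0 0 0 (suc a) b c _ = _ , refl
    parts-nonzero 0 0 0 0 (suc b) c _ = _ , refl
    parts-nonzero 0 0 0 0 0 (suc c) _ = _ , refl

  module _ (n₁ n₂ n₃ : ℕ) where

    shift-pred₁₂ : ∀ i j l → shift (i ℕ.+ l) (i ℕ.+ j ℕ.+ l) (j ℕ.+ l) (λ a b c → atPred i λ i′ → φ i′ j l a b c) n₁ n₂ n₃
                           ≡ atPred i λ i′ → shift 1 1 0 (term i′ j l) n₁ n₂ n₃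
    shift-pred₁₂ zero    j l = shift-zero l (j ℕ.+ l) (j ℕ.+ l) n₁ n₂ n₃
    shift-pred₁₂ (suc i) j l = sym (shift-shift 1 1 0 (i ℕ.+ l) (i ℕ.+ j ℕ.+ l) (j ℕ.+ l) (φ i j l) n₁ n₂ n₃)

    shift-pred₂₃ : ∀ i j l → shift (i ℕ.+ l) (i ℕ.+ j ℕ.+ l) (j ℕ.+ l) (λ a b c → atPred j λ j′ → φ i j′ l a b c) n₁ n₂ n₃
                           ≡ atPred j λ j′ → shift 0 1 1 (term i j′ l) n₁ n₂ n₃
    shift-pred₂₃ i zero    l = shift-zero (i ℕ.+ l) (i ℕ.+ 0 ℕ.+ l) l n₁ n₂ n₃
    shift-pred₂₃ i (suc j) l =
      trans (shift-index {k₁ = i ℕ.+ l} {k₃ = suc j ℕ.+ l} refl (cong (ℕ._+ l) (ℕ.+-suc i j)) refl (φ i j l) n₁ n₂ n₃)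
            (sym (shift-shift 0 1 1 (i ℕ.+ l) (i ℕ.+ j ℕ.+ l) (j ℕ.+ l) (φ i j l) n₁ n₂ n₃))

    shift-pred₁₂₃ : ∀ i j l → shift (i ℕ.+ l) (i ℕ.+ j ℕ.+ l) (j ℕ.+ l) (λ a b c → atPred l λ l′ → φ i j l′ a b c) n₁ n₂ n₃
                            ≡ atPred l λ l′ → shift 1 1 1 (term i j l′) n₁ n₂ n₃
    shift-pred₁₂₃ i j zero    = shift-zero (i ℕ.+ 0) (i ℕ.+ j ℕ.+ 0) (j ℕ.+ 0) n₁ n₂ n₃
    shift-pred₁₂₃ i j (suc l) =
      trans (shift-index (ℕ.+-suc i l) (ℕ.+-suc (i ℕ.+ j) l) (ℕ.+-suc j l) (φ i j l) n₁ n₂ n₃)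
            (sym (shift-shift 1 1 1 (i ℕ.+ l) (i ℕ.+ j ℕ.+ l) (j ℕ.+ l) (φ i j l) n₁ n₂ n₃))

    term-step : Pascal₆ → ∀ i j l t → n₁ ℕ.+ n₂ ℕ.+ n₃ ≡ suc t → term i j l n₁ n₂ n₃ ≡
      tiles x (shift 1 0 0 (term i j l) n₁ n₂ n₃) (shift 0 1 0 (term i j l) n₁ n₂ n₃) (shift 0 0 1 (term i j l) n₁ n₂ n₃)
              (atPred i λ i′ → shift 1 1 0 (term i′ j l) n₁ n₂ n₃)
              (atPred j λ j′ → shift 0 1 1 (term i j′ l) n₁ n₂ n₃)
              (atPred l λ l′ → shift 1 1 1 (term i j l′) n₁ n₂ n₃)
    term-step pascal i j l t total = begin
      S (φ i j l)
        ≡⟨ shift-cong k₁ k₂ k₃ n₁ n₂ n₃ (λ where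
             a b c refl refl refl → let t′ , e = parts-nonzero i j l a b c total in pascal i j l a b c t′ e) ⟩
      S (λ a b c → tiles x (T₁ a b c) (T₂ a b c) (T₃ a b c) (T₁₂ a b c) (T₂₃ a b c) (T₁₂₃ a b c))
        ≡⟨ tiles-linear S (shift-+ k₁ k₂ k₃ n₁ n₂ n₃) (shift-* k₁ k₂ k₃ n₁ n₂ n₃) x T₁ T₂ T₃ T₁₂ T₂₃ T₁₂₃ ⟩
      tiles x (S T₁) (S T₂) (S T₃) (S T₁₂) (S T₂₃) (S T₁₂₃)
        ≡⟨ tiles-cong x (shift-shift-comm k₁ k₂ k₃ 1 0 0 (φ i j l) n₁ n₂ n₃) (shift-shift-comm k₁ k₂ k₃ 0 1 0 (φ i j l) n₁ n₂ n₃)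
                        (shift-shift-comm k₁ k₂ k₃ 0 0 1 (φ i j l) n₁ n₂ n₃)
                        (shift-pred₁₂ i j l) (shift-pred₂₃ i j l) (shift-pred₁₂₃ i j l) ⟩
      _ ∎
      where
      k₁ = i ℕ.+ l
      k₂ = i ℕ.+ j ℕ.+ l
      k₃ = j ℕ.+ l
      S : Grid → ℤ
      S F = shift k₁ k₂ k₃ F n₁ n₂ n₃
      T₁ T₂ T₃ T₁₂ T₂₃ T₁₂₃ : Grid
      T₁ = shift 1 0 0 (φ i j l)
      T₂ = shift 0 1 0 (φ i j l)
      T₃ = shift 0 0 1 (φ i j l)
      T₁₂ a b c = atPred i λ i′ → φ i′ j l a b c
      T₂₃ a b c = atPred j λ j′ → φ i j′ l a b c
      T₁₂₃ a b c = atPred l λ l′ → φ i j l′ a b c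

  Σbox-pred₁₂ : ∀ n₁ n₂ n₃ → Σbox n₁ n₂ n₃ (λ i j l → atPred i λ i′ → shift 1 1 0 (term i′ j l) n₁ n₂ n₃) ≡ shift 1 1 0 boxSum n₁ n₂ n₃
  Σbox-pred₁₂ zero    n₂ n₃ = Σbox-atPred₁ 0 n₂ n₃ λ i j l → shift 1 1 0 (term i j l) 0 n₂ n₃
  Σbox-pred₁₂ (suc m) n₂ n₃ =
    trans (Σbox-atPred₁ (suc m) n₂ n₃ λ i j l → shift 1 1 0 (term i j l) (suc m) n₂ n₃)
          (Σbox-shift-term m n₂ n₃ 1 1 0 (suc m) n₂ n₃ ℕ.≤-refl (ℕ.n≤1+n n₂) ℕ.≤-refl)

  Σbox-pred₂₃ : ∀ n₁ n₂ n₃ → Σbox n₁ n₂ n₃ (λ i j l → atPred j λ j′ → shift 0 1 1 (term i j′ l) n₁ n₂ n₃) ≡ shift 0 1 1 boxSum n₁ n₂ n₃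
  Σbox-pred₂₃ n₁ zero    n₃ = Σbox-atPred₂ n₁ 0 n₃ λ i j l → shift 0 1 1 (term i j l) n₁ 0 n₃
  Σbox-pred₂₃ n₁ (suc m) n₃ =
    trans (Σbox-atPred₂ n₁ (suc m) n₃ λ i j l → shift 0 1 1 (term i j l) n₁ (suc m) n₃)
          (Σbox-shift-term n₁ m n₃ 0 1 1 n₁ (suc m) n₃ ℕ.≤-refl ℕ.≤-refl (ℕ.n≤1+n n₃))

  Σbox-pred₁₂₃ : ∀ n₁ n₂ n₃ → Σbox n₁ n₂ n₃ (λ i j l → atPred l λ l′ → shift 1 1 1 (term i j l′) n₁ n₂ n₃) ≡ shift 1 1 1 boxSum n₁ n₂ n₃
  Σbox-pred₁₂₃ n₁ n₂ zero    =
    trans (Σbox-atPred₃ n₁ n₂ 0 λ i j l → shift 1 1 1 (term i j l) n₁ n₂ 0)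
          (sym (shift-vanishes 1 1 1 n₁ n₂ 0 {boxSum} λ _ _ _ _ _ ()))
  Σbox-pred₁₂₃ n₁ n₂ (suc m) =
    trans (Σbox-atPred₃ n₁ n₂ (suc m) λ i j l → shift 1 1 1 (term i j l) n₁ n₂ (suc m))
          (Σbox-shift-term n₁ n₂ m 1 1 1 n₁ n₂ (suc m) (ℕ.n≤1+n n₁) (ℕ.n≤1+n n₂) ℕ.≤-refl)

  boxSum-recurrence : Pascal₆ → TileRecurrence x boxSum
  boxSum-recurrence pascal n₁ n₂ n₃ t total = begin
    Σbox n₁ n₂ n₃ (λ i j l → term i j l n₁ n₂ n₃)
      ≡⟨ Σbox-cong n₁ n₂ n₃ (λ i j l → term-step n₁ n₂ n₃ pascal i j l t total) ⟩
    Σbox n₁ n₂ n₃ (λ i j l → tiles x (T₁ i j l) (T₂ i j l) (T₃ i j l) (T₁₂ i j l) (T₂₃ i j l) (T₁₂₃ i j l))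
      ≡⟨ tiles-linear (Σbox n₁ n₂ n₃) (Σbox-+ n₁ n₂ n₃) (Σbox-* n₁ n₂ n₃) x T₁ T₂ T₃ T₁₂ T₂₃ T₁₂₃ ⟩
    tiles x (Σbox n₁ n₂ n₃ T₁) (Σbox n₁ n₂ n₃ T₂) (Σbox n₁ n₂ n₃ T₃) (Σbox n₁ n₂ n₃ T₁₂) (Σbox n₁ n₂ n₃ T₂₃) (Σbox n₁ n₂ n₃ T₁₂₃)
      ≡⟨ tiles-cong x (Σbox-shift-term n₁ n₂ n₃ 1 0 0 n₁ n₂ n₃ (ℕ.n≤1+n n₁) ℕ.≤-refl ℕ.≤-refl)
                      (Σbox-shift-term n₁ n₂ n₃ 0 1 0 n₁ n₂ n₃ ℕ.≤-refl (ℕ.n≤1+n n₂) ℕ.≤-refl)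
                      (Σbox-shift-term n₁ n₂ n₃ 0 0 1 n₁ n₂ n₃ ℕ.≤-refl ℕ.≤-refl (ℕ.n≤1+n n₃))
                      (Σbox-pred₁₂ n₁ n₂ n₃) (Σbox-pred₂₃ n₁ n₂ n₃) (Σbox-pred₁₂₃ n₁ n₂ n₃) ⟩
    tileStep x boxSum n₁ n₂ n₃ ∎
    where
    T₁ T₂ T₃ T₁₂ T₂₃ T₁₂₃ : Grid
    T₁ i j l = shift 1 0 0 (term i j l) n₁ n₂ n₃
    T₂ i j l = shift 0 1 0 (term i j l) n₁ n₂ n₃
    T₃ i j l = shift 0 0 1 (term i j l) n₁ n₂ n₃
    T₁₂ i j l = atPred i λ i′ → shift 1 1 0 (term i′ j l) n₁ n₂ n₃
    T₂₃ i j l = atPred j λ j′ → shift 0 1 1 (term i j′ l) n₁ n₂ n₃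
    T₁₂₃ i j l = atPred l λ l′ → shift 1 1 1 (term i j l′) n₁ n₂ n₃

-- The right-hand side

module MultinomialSum (w : ℤ) where

  private
    x : ℤ
    x = w - + 1

  M : ℕ → ℕ → ℕ → Grid
  M i j l a b c = + multinomial (i ∷ j ∷ l ∷ a ∷ b ∷ c ∷ [])

  X : ℕ → ℕ → ℕ → ℤ
  X i j l = x ^ (i ℕ.+ j ℕ.+ 2 ℕ.* l)

  φ : ℕ → ℕ → ℕ → Grid
  φ i j l a b c = M i j l a b c * X i j l

  open BoxSum x φ public

  module _ (a b c : ℕ) where

    private
      pull₁ : ∀ m x y → m * (x * y) ≡ x * (m * y)
      pull₁ = solve-∀
      pull₂ : ∀ m x y → m * (x * (x * y)) ≡ x * x * (m * y)
      pull₂ = solve-∀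
      two-suc : ∀ i j l → i ℕ.+ j ℕ.+ 2 ℕ.* suc l ≡ suc (suc (i ℕ.+ j ℕ.+ 2 ℕ.* l))
      two-suc = ℕ-Ring.solve-∀

    φ-pred₁₂ : ∀ i j l → (atPred i λ i′ → M i′ j l a b c) * X i j l ≡ x * atPred i λ i′ → φ i′ j l a b c
    φ-pred₁₂ zero    j l = trans (ℤ.*-zeroˡ (X 0 j l)) (sym (ℤ.*-zeroʳ x))
    φ-pred₁₂ (suc i) j l = pull₁ (M i j l a b c) x (X i j l)

    φ-pred₂₃ : ∀ i j l → (atPred j λ j′ → M i j′ l a b c) * X i j l ≡ x * atPred j λ j′ → φ i j′ l a b c
    φ-pred₂₃ i zero    l = trans (ℤ.*-zeroˡ (X i 0 l)) (sym (ℤ.*-zeroʳ x))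
    φ-pred₂₃ i (suc j) l rewrite ℕ.+-suc i j = pull₁ (M i j l a b c) x (X i j l)

    φ-pred₁₂₃ : ∀ i j l → (atPred l λ l′ → M i j l′ a b c) * X i j l ≡ x * x * atPred l λ l′ → φ i j l′ a b c
    φ-pred₁₂₃ i j zero    = trans (ℤ.*-zeroˡ (X i j 0)) (sym (ℤ.*-zeroʳ (x * x)))
    φ-pred₁₂₃ i j (suc l) rewrite two-suc i j l = pull₂ (M i j l a b c) x (X i j l)

  φ-pascal : Pascal₆
  φ-pascal i j l a b c t e = begin
    M i j l a b c * Y
      ≡⟨ cong (_* Y) (multinomial-pascal (i ∷ j ∷ l ∷ a ∷ b ∷ c ∷ []) (trans (sum-six i j l a b c) e)) ⟩
    (Pi + (Pj + (Pl + (Pa + (Pb + (Pc + 0ℤ)))))) * Y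
      ≡⟨ spread Pi Pj Pl Pa Pb Pc Y ⟩
    Pa * Y + Pb * Y + Pc * Y + Pi * Y + Pj * Y + Pl * Y
      ≡⟨ cong₂ _+_ (cong₂ _+_ (cong₂ _+_ (cong₂ _+_ (cong₂ _+_
           (sym (atPred-*ʳ a _ Y)) (sym (atPred-*ʳ b _ Y))) (sym (atPred-*ʳ c _ Y)))
           (φ-pred₁₂ a b c i j l)) (φ-pred₂₃ a b c i j l)) (φ-pred₁₂₃ a b c i j l) ⟩
    tiles x (atPred a λ a′ → φ i j l a′ b c) (atPred b λ b′ → φ i j l a b′ c) (atPred c λ c′ → φ i j l a b c′)
            (atPred i λ i′ → φ i′ j l a b c) (atPred j λ j′ → φ i j′ l a b c) (atPred l λ l′ → φ i j l′ a b c) ∎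
    where
    Y = X i j l
    Pa = atPred a λ a′ → M i j l a′ b c
    Pb = atPred b λ b′ → M i j l a b′ c
    Pc = atPred c λ c′ → M i j l a b c′
    Pi = atPred i λ i′ → M i′ j l a b c
    Pj = atPred j λ j′ → M i j′ l a b c
    Pl = atPred l λ l′ → M i j l′ a b c
    sum-six : ∀ i j l a b c → i ℕ.+ (j ℕ.+ (l ℕ.+ (a ℕ.+ (b ℕ.+ (c ℕ.+ 0))))) ≡ i ℕ.+ j ℕ.+ l ℕ.+ a ℕ.+ b ℕ.+ c
    sum-six = ℕ-Ring.solve-∀
    spread : ∀ Pi Pj Pl Pa Pb Pc Y → (Pi + (Pj + (Pl + (Pa + (Pb + (Pc + 0ℤ)))))) * Y
                                     ≡ Pa * Y + Pb * Y + Pc * Y + Pi * Y + Pj * Y + Pl * Y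
    spread = solve-∀

  boxSum-RHS₃ : ∀ n₁ n₂ n₃ → boxSum n₁ n₂ n₃ ≡ RHS₃ w n₁ n₂ n₃
  boxSum-RHS₃ n₁ n₂ n₃ = Σbox-cong n₁ n₂ n₃ λ i j l → begin
    term i j l n₁ n₂ n₃
      ≡⟨ trans (atSub-if (i ℕ.+ l) n₁ _) (cong (if i ℕ.+ l ℕ.≤ᵇ n₁ then_else 0ℤ)
         (trans (atSub-if (i ℕ.+ j ℕ.+ l) n₂ _) (cong (if i ℕ.+ j ℕ.+ l ℕ.≤ᵇ n₂ then_else 0ℤ) (atSub-if (j ℕ.+ l) n₃ _)))) ⟩
    (if i ℕ.+ l ℕ.≤ᵇ n₁ then (if i ℕ.+ j ℕ.+ l ℕ.≤ᵇ n₂ then (if j ℕ.+ l ℕ.≤ᵇ n₃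
       then φ i j l (n₁ ℕ.∸ (i ℕ.+ l)) (n₂ ℕ.∸ (i ℕ.+ j ℕ.+ l)) (n₃ ℕ.∸ (j ℕ.+ l)) else 0ℤ) else 0ℤ) else 0ℤ)
      ≡⟨ if-∧ (i ℕ.+ l ℕ.≤ᵇ n₁) (i ℕ.+ j ℕ.+ l ℕ.≤ᵇ n₂) (j ℕ.+ l ℕ.≤ᵇ n₃) _ ⟩
    (if (i ℕ.+ l ℕ.≤ᵇ n₁) ∧ (i ℕ.+ j ℕ.+ l ℕ.≤ᵇ n₂) ∧ (j ℕ.+ l ℕ.≤ᵇ n₃)
       then φ i j l (n₁ ℕ.∸ (i ℕ.+ l)) (n₂ ℕ.∸ (i ℕ.+ j ℕ.+ l)) (n₃ ℕ.∸ (j ℕ.+ l)) else 0ℤ)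
      ≡⟨ cong (if (i ℕ.+ l ℕ.≤ᵇ n₁) ∧ (i ℕ.+ j ℕ.+ l ℕ.≤ᵇ n₂) ∧ (j ℕ.+ l ℕ.≤ᵇ n₃) then_else 0ℤ) (sym
           (cong₃ (φ i j l) (ℕ.∸-+-assoc n₁ i l) (trans (cong (ℕ._∸ l) (ℕ.∸-+-assoc n₂ i j)) (ℕ.∸-+-assoc n₂ (i ℕ.+ j) l)) (ℕ.∸-+-assoc n₃ j l))) ⟩
    (if (i ℕ.+ l ℕ.≤ᵇ n₁) ∧ (i ℕ.+ j ℕ.+ l ℕ.≤ᵇ n₂) ∧ (j ℕ.+ l ℕ.≤ᵇ n₃)
       then φ i j l (n₁ ℕ.∸ i ℕ.∸ l) (n₂ ℕ.∸ i ℕ.∸ j ℕ.∸ l) (n₃ ℕ.∸ j ℕ.∸ l) else 0ℤ) ∎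
    where
    if-∧ : ∀ p q r (z : ℤ) → (if p then (if q then (if r then z else 0ℤ) else 0ℤ) else 0ℤ) ≡ (if p ∧ q ∧ r then z else 0ℤ)
    if-∧ true  true  r z = refl
    if-∧ true  false r z = refl
    if-∧ false q     r z = refl
    cong₃ : ∀ (f : ℕ → ℕ → ℕ → ℤ) {a a′ b b′ c c′} → a ≡ a′ → b ≡ b′ → c ≡ c′ → f a b c ≡ f a′ b′ c′
    cong₃ f refl refl refl = refl

-- Words and their rises

byTotal : ∀ (P : ℕ → ℕ → ℕ → Set) → P 0 0 0 → (∀ n₁ n₂ n₃ t → n₁ ℕ.+ n₂ ℕ.+ n₃ ≡ suc t → P n₁ n₂ n₃) →
  ∀ n₁ n₂ n₃ → P n₁ n₂ n₃
byTotal P p₀ pₛ zero    zero    zero    = p₀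
byTotal P p₀ pₛ (suc a) b       c       = pₛ _ _ _ _ refl
byTotal P p₀ pₛ zero    (suc b) c       = pₛ _ _ _ _ refl
byTotal P p₀ pₛ zero    zero    (suc c) = pₛ _ _ _ _ refl

-- Words of length k have content of total k, so only this diagonal of a length-graded family matters.
ungraded : (ℕ → Grid) → Grid
ungraded G n₁ n₂ n₃ = G (n₁ ℕ.+ n₂ ℕ.+ n₃) n₁ n₂ n₃

shift-ungraded : ∀ k₁ k₂ k₃ n₁ n₂ n₃ t (G : ℕ → Grid) → n₁ ℕ.+ n₂ ℕ.+ n₃ ≡ (k₁ ℕ.+ k₂ ℕ.+ k₃) ℕ.+ t →
  shift k₁ k₂ k₃ (G t) n₁ n₂ n₃ ≡ shift k₁ k₂ k₃ (ungraded G) n₁ n₂ n₃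
shift-ungraded k₁ k₂ k₃ n₁ n₂ n₃ t G e = shift-cong k₁ k₂ k₃ n₁ n₂ n₃ λ where
  a b c refl refl refl → cong (λ s → G s a b c) (ℕ.+-cancelˡ-≡ (k₁ ℕ.+ k₂ ℕ.+ k₃) t _ (trans (sym e) (sym (+-interchange₃ k₁ k₂ k₃ a b c))))

rise : Fin 3 → Fin 3 → ℕ
rise a b = if does (toℕ b ℕ.≟ suc (toℕ a)) then 1 else 0

rise≤1 : ∀ a b → rise a b ℕ.≤ 1
rise≤1 a b with does (toℕ b ℕ.≟ suc (toℕ a))
... | true  = ℕ.≤-refl
... | false = ℕ.z≤n

rises≤length : ∀ as → rises as ℕ.≤ length as
rises≤length []           = ℕ.z≤n
rises≤length (a ∷ [])     = ℕ.z≤n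
rises≤length (a ∷ b ∷ as) = ℕ.+-mono-≤ (rise≤1 a b) (rises≤length (b ∷ as))

allSeqs-length : ∀ k → All (λ as → length as ≡ k) (allSeqs k)
allSeqs-length zero    = refl ∷ []
allSeqs-length (suc k) = AllP.concat⁺ (AllP.map⁺ (All.map (λ e → cong suc e ∷ cong suc e ∷ cong suc e ∷ []) (allSeqs-length k)))

letters : List (Fin 3)
letters = Fin.zero ∷ Fin.suc Fin.zero ∷ Fin.suc (Fin.suc Fin.zero) ∷ []

shiftBy : Fin 3 → Grid → Grid
shiftBy Fin.zero                   = shift 1 0 0
shiftBy (Fin.suc Fin.zero)         = shift 0 1 0
shiftBy (Fin.suc (Fin.suc Fin.zero)) = shift 0 0 1

allSeqs-suc : ∀ k (f : List (Fin 3) → ℤ) →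
  sumOver (allSeqs (suc k)) f ≡ sumOver letters (λ c → sumOver (allSeqs k) (λ xs → f (c ∷ xs)))
allSeqs-suc k f =
  trans (sumOver-concatMap _ (allSeqs k) f)
 (trans (sumOver-cong (allSeqs k) λ xs → sumOver-map (_∷ xs) letters f) (sumOver-swap (allSeqs k) letters λ xs c → f (c ∷ xs)))

module Words (w : ℤ) where

  weight : ℕ → ℕ → ℕ → List (Fin 3) → ℤ
  weight n₁ n₂ n₃ as = if hasContent n₁ n₂ n₃ as then w ^ rises as else 0ℤ

  weightAfter : Fin 3 → ℕ → ℕ → ℕ → List (Fin 3) → ℤ
  weightAfter a n₁ n₂ n₃ as = if hasContent n₁ n₂ n₃ as then w ^ rises (a ∷ as) else 0ℤ

  wordSum : ℕ → Grid
  wordSum k n₁ n₂ n₃ = sumOver (allSeqs k) (weight n₁ n₂ n₃)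

  sumAfter : Fin 3 → ℕ → Grid
  sumAfter a k n₁ n₂ n₃ = sumOver (allSeqs k) (weightAfter a n₁ n₂ n₃)

  weight-cons : ∀ a n₁ n₂ n₃ xs → weight n₁ n₂ n₃ (a ∷ xs) ≡ shiftBy a (λ m₁ m₂ m₃ → weightAfter a m₁ m₂ m₃ xs) n₁ n₂ n₃
  weight-cons Fin.zero                     zero    n₂      n₃      xs = refl
  weight-cons Fin.zero                     (suc m) n₂      n₃      xs = refl
  weight-cons (Fin.suc Fin.zero)           n₁      zero    n₃      xs
    rewrite ∧-zeroʳ (does (count Fin.zero xs ℕ.≟ n₁)) = refl
  weight-cons (Fin.suc Fin.zero)           n₁      (suc m) n₃      xs = refl
  weight-cons (Fin.suc (Fin.suc Fin.zero)) n₁      n₂      zero    xs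
    rewrite ∧-zeroʳ (does (count (Fin.suc Fin.zero) xs ℕ.≟ n₂)) | ∧-zeroʳ (does (count Fin.zero xs ℕ.≟ n₁)) = refl
  weight-cons (Fin.suc (Fin.suc Fin.zero)) n₁      n₂      (suc m) xs = refl

  weightAfter-cons : ∀ a b n₁ n₂ n₃ xs → weightAfter a n₁ n₂ n₃ (b ∷ xs) ≡ w ^ rise a b * weight n₁ n₂ n₃ (b ∷ xs)
  weightAfter-cons a b n₁ n₂ n₃ xs with hasContent n₁ n₂ n₃ (b ∷ xs)
  ... | true  = ℤ.^-distribˡ-+-* w (rise a b) (rises (b ∷ xs))
  ... | false = sym (ℤ.*-zeroʳ (w ^ rise a b))

  sum-weight-cons : ∀ k n₁ n₂ n₃ a → sumOver (allSeqs k) (λ xs → weight n₁ n₂ n₃ (a ∷ xs)) ≡ shiftBy a (sumAfter a k) n₁ n₂ n₃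
  sum-weight-cons k n₁ n₂ n₃ a = trans (sumOver-cong (allSeqs k) (weight-cons a n₁ n₂ n₃)) (commute a)
    where
    L : (List (Fin 3) → ℤ) → ℤ
    L = sumOver (allSeqs k)
    G : Fin 3 → List (Fin 3) → Grid
    G a xs m₁ m₂ m₃ = weightAfter a m₁ m₂ m₃ xs
    commute : ∀ a → L (λ xs → shiftBy a (λ m₁ m₂ m₃ → weightAfter a m₁ m₂ m₃ xs) n₁ n₂ n₃) ≡ shiftBy a (sumAfter a k) n₁ n₂ n₃
    commute Fin.zero                     = shift-commutes 1 0 0 n₁ n₂ n₃ L (sumOver-zero (allSeqs k)) (G Fin.zero)
    commute (Fin.suc Fin.zero)           = shift-commutes 0 1 0 n₁ n₂ n₃ L (sumOver-zero (allSeqs k)) (G (Fin.suc Fin.zero))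
    commute (Fin.suc (Fin.suc Fin.zero)) = shift-commutes 0 0 1 n₁ n₂ n₃ L (sumOver-zero (allSeqs k)) (G (Fin.suc (Fin.suc Fin.zero)))

  wordSum-suc : ∀ k n₁ n₂ n₃ → wordSum (suc k) n₁ n₂ n₃ ≡ sumOver letters (λ a → shiftBy a (sumAfter a k) n₁ n₂ n₃)
  wordSum-suc k n₁ n₂ n₃ = trans (allSeqs-suc k (weight n₁ n₂ n₃)) (sumOver-cong letters (sum-weight-cons k n₁ n₂ n₃))

  sumAfter-suc : ∀ a k n₁ n₂ n₃ →
    sumAfter a (suc k) n₁ n₂ n₃ ≡ sumOver letters (λ b → w ^ rise a b * shiftBy b (sumAfter b k) n₁ n₂ n₃)
  sumAfter-suc a k n₁ n₂ n₃ = trans (allSeqs-suc k (weightAfter a n₁ n₂ n₃)) (sumOver-cong letters λ b →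
    trans (sumOver-cong (allSeqs k) (weightAfter-cons a b n₁ n₂ n₃))
   (trans (sumOver-* (allSeqs k) (w ^ rise a b) _) (cong (w ^ rise a b *_) (sum-weight-cons k n₁ n₂ n₃ b))))

  x : ℤ
  x = w - + 1

  private
    c₁ c₂ c₃ : Fin 3
    c₁ = Fin.zero
    c₂ = Fin.suc Fin.zero
    c₃ = Fin.suc (Fin.suc Fin.zero)

  sumAfter-c₃ : ∀ k n₁ n₂ n₃ → sumAfter c₃ k n₁ n₂ n₃ ≡ wordSum k n₁ n₂ n₃
  sumAfter-c₃ zero    n₁ n₂ n₃ = refl
  sumAfter-c₃ (suc k) n₁ n₂ n₃ =
    trans (sumAfter-suc c₃ k n₁ n₂ n₃) (trans (no-rise (S c₁) (S c₂) (S c₃)) (sym (wordSum-suc k n₁ n₂ n₃)))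
    where
    S : Fin 3 → ℤ
    S a = shiftBy a (sumAfter a k) n₁ n₂ n₃
    no-rise : ∀ S₁ S₂ S₃ → 1ℤ * S₁ + (1ℤ * S₂ + (1ℤ * S₃ + 0ℤ)) ≡ S₁ + (S₂ + (S₃ + 0ℤ))
    no-rise = solve-∀

  sumAfter-c₂ : ∀ k n₁ n₂ n₃ → sumAfter c₂ (suc k) n₁ n₂ n₃ ≡ wordSum (suc k) n₁ n₂ n₃ + x * shift 0 0 1 (sumAfter c₃ k) n₁ n₂ n₃
  sumAfter-c₂ k n₁ n₂ n₃ =
    trans (sumAfter-suc c₂ k n₁ n₂ n₃) (trans (rise-to-c₃ w (S c₁) (S c₂) (S c₃)) (cong (_+ x * S c₃) (sym (wordSum-suc k n₁ n₂ n₃))))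
    where
    S : Fin 3 → ℤ
    S a = shiftBy a (sumAfter a k) n₁ n₂ n₃
    rise-to-c₃ : ∀ w S₁ S₂ S₃ → 1ℤ * S₁ + (1ℤ * S₂ + (w * 1ℤ * S₃ + 0ℤ)) ≡ S₁ + (S₂ + (S₃ + 0ℤ)) + (w - + 1) * S₃
    rise-to-c₃ = solve-∀

  sumAfter-c₁ : ∀ k n₁ n₂ n₃ → sumAfter c₁ (suc k) n₁ n₂ n₃ ≡ wordSum (suc k) n₁ n₂ n₃ + x * shift 0 1 0 (sumAfter c₂ k) n₁ n₂ n₃
  sumAfter-c₁ k n₁ n₂ n₃ =
    trans (sumAfter-suc c₁ k n₁ n₂ n₃) (trans (rise-to-c₂ w (S c₁) (S c₂) (S c₃)) (cong (_+ x * S c₂) (sym (wordSum-suc k n₁ n₂ n₃))))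
    where
    S : Fin 3 → ℤ
    S a = shiftBy a (sumAfter a k) n₁ n₂ n₃
    rise-to-c₂ : ∀ w S₁ S₂ S₃ → 1ℤ * S₁ + (w * 1ℤ * S₂ + (1ℤ * S₃ + 0ℤ)) ≡ S₁ + (S₂ + (S₃ + 0ℤ)) + (w - + 1) * S₂
    rise-to-c₂ = solve-∀

  ungraded-sumAfter-c₃ : ∀ n₁ n₂ n₃ → ungraded (sumAfter c₃) n₁ n₂ n₃ ≡ ungraded wordSum n₁ n₂ n₃
  ungraded-sumAfter-c₃ n₁ n₂ n₃ = sumAfter-c₃ (n₁ ℕ.+ n₂ ℕ.+ n₃) n₁ n₂ n₃

  ungraded-sumAfter-c₂ : ∀ n₁ n₂ n₃ →
    ungraded (sumAfter c₂) n₁ n₂ n₃ ≡ ungraded wordSum n₁ n₂ n₃ + x * shift 0 0 1 (ungraded (sumAfter c₃)) n₁ n₂ n₃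
  ungraded-sumAfter-c₂ = byTotal _ (sym (+-congˡ {1ℤ} (ℤ.*-zeroʳ x))) λ n₁ n₂ n₃ t e → begin
    sumAfter c₂ (n₁ ℕ.+ n₂ ℕ.+ n₃) n₁ n₂ n₃                                ≡⟨ cong (λ k → sumAfter c₂ k n₁ n₂ n₃) e ⟩
    sumAfter c₂ (suc t) n₁ n₂ n₃                                           ≡⟨ sumAfter-c₂ t n₁ n₂ n₃ ⟩
    wordSum (suc t) n₁ n₂ n₃ + x * shift 0 0 1 (sumAfter c₃ t) n₁ n₂ n₃
      ≡⟨ cong₂ (λ k z → wordSum k n₁ n₂ n₃ + x * z) (sym e) (shift-ungraded 0 0 1 n₁ n₂ n₃ t (sumAfter c₃) e) ⟩
    ungraded wordSum n₁ n₂ n₃ + x * shift 0 0 1 (ungraded (sumAfter c₃)) n₁ n₂ n₃ ∎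

  ungraded-sumAfter-c₁ : ∀ n₁ n₂ n₃ →
    ungraded (sumAfter c₁) n₁ n₂ n₃ ≡ ungraded wordSum n₁ n₂ n₃ + x * shift 0 1 0 (ungraded (sumAfter c₂)) n₁ n₂ n₃
  ungraded-sumAfter-c₁ = byTotal _ (sym (+-congˡ {1ℤ} (ℤ.*-zeroʳ x))) λ n₁ n₂ n₃ t e → begin
    sumAfter c₁ (n₁ ℕ.+ n₂ ℕ.+ n₃) n₁ n₂ n₃                                ≡⟨ cong (λ k → sumAfter c₁ k n₁ n₂ n₃) e ⟩
    sumAfter c₁ (suc t) n₁ n₂ n₃                                           ≡⟨ sumAfter-c₁ t n₁ n₂ n₃ ⟩
    wordSum (suc t) n₁ n₂ n₃ + x * shift 0 1 0 (sumAfter c₂ t) n₁ n₂ n₃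
      ≡⟨ cong₂ (λ k z → wordSum k n₁ n₂ n₃ + x * z) (sym e) (shift-ungraded 0 1 0 n₁ n₂ n₃ t (sumAfter c₂) e) ⟩
    ungraded wordSum n₁ n₂ n₃ + x * shift 0 1 0 (ungraded (sumAfter c₂)) n₁ n₂ n₃ ∎

  wordSum-first-letter : ∀ n₁ n₂ n₃ t → n₁ ℕ.+ n₂ ℕ.+ n₃ ≡ suc t → ungraded wordSum n₁ n₂ n₃ ≡
    shift 1 0 0 (ungraded (sumAfter c₁)) n₁ n₂ n₃ + shift 0 1 0 (ungraded (sumAfter c₂)) n₁ n₂ n₃ + shift 0 0 1 (ungraded (sumAfter c₃)) n₁ n₂ n₃
  wordSum-first-letter n₁ n₂ n₃ t e = begin
    wordSum (n₁ ℕ.+ n₂ ℕ.+ n₃) n₁ n₂ n₃          ≡⟨ cong (λ k → wordSum k n₁ n₂ n₃) e ⟩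
    wordSum (suc t) n₁ n₂ n₃                      ≡⟨ wordSum-suc t n₁ n₂ n₃ ⟩
    S 1 0 0 (sumAfter c₁ t) + (S 0 1 0 (sumAfter c₂ t) + (S 0 0 1 (sumAfter c₃ t) + 0ℤ))
      ≡⟨ cong₂ _+_ (ungrade 1 0 0 c₁ refl) (cong₂ _+_ (ungrade 0 1 0 c₂ refl) (+-congʳ (ungrade 0 0 1 c₃ refl))) ⟩
    S 1 0 0 (ungraded (sumAfter c₁)) + (S 0 1 0 (ungraded (sumAfter c₂)) + (S 0 0 1 (ungraded (sumAfter c₃)) + 0ℤ))
      ≡⟨ assoc (S 1 0 0 (ungraded (sumAfter c₁))) (S 0 1 0 (ungraded (sumAfter c₂))) (S 0 0 1 (ungraded (sumAfter c₃))) ⟩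
    S 1 0 0 (ungraded (sumAfter c₁)) + S 0 1 0 (ungraded (sumAfter c₂)) + S 0 0 1 (ungraded (sumAfter c₃)) ∎
    where
    S : ℕ → ℕ → ℕ → Grid → ℤ
    S k₁ k₂ k₃ F = shift k₁ k₂ k₃ F n₁ n₂ n₃
    ungrade : ∀ k₁ k₂ k₃ a → k₁ ℕ.+ k₂ ℕ.+ k₃ ≡ 1 → S k₁ k₂ k₃ (sumAfter a t) ≡ S k₁ k₂ k₃ (ungraded (sumAfter a))
    ungrade k₁ k₂ k₃ a h = shift-ungraded k₁ k₂ k₃ n₁ n₂ n₃ t (sumAfter a) (trans e (cong (ℕ._+ t) (sym h)))
    assoc : ∀ a b c → a + (b + (c + 0ℤ)) ≡ a + b + c
    assoc = solve-∀

  wordSum-recurrence : TileRecurrence x (ungraded wordSum)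
  wordSum-recurrence n₁ n₂ n₃ t e = begin
    f n₁ n₂ n₃
      ≡⟨ wordSum-first-letter n₁ n₂ n₃ t e ⟩
    S 1 0 0 g₁ + S 0 1 0 g₂ + S 0 0 1 g₃
      ≡⟨ cong₂ _+_ (cong₂ _+_ (shift-affine 1 0 0 0 1 0 n₁ n₂ n₃ x {g₁} {f} {g₂} ungraded-sumAfter-c₁)
                              (shift-affine 0 1 0 0 0 1 n₁ n₂ n₃ x {g₂} {f} {g₃} ungraded-sumAfter-c₂))
                   (g₃≡f 0 0 1) ⟩
    S 1 0 0 f + x * S 1 1 0 g₂ + (S 0 1 0 f + x * S 0 1 1 g₃) + S 0 0 1 f
      ≡⟨ cong₂ (λ p q → S 1 0 0 f + x * p + (S 0 1 0 f + x * q) + S 0 0 1 f)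
               (trans (shift-affine 1 1 0 0 0 1 n₁ n₂ n₃ x {g₂} {f} {g₃} ungraded-sumAfter-c₂)
                      (+-congˡ {S 1 1 0 f} (cong (x *_) (g₃≡f 1 1 1))))
               (g₃≡f 0 1 1) ⟩
    S 1 0 0 f + x * (S 1 1 0 f + x * S 1 1 1 f) + (S 0 1 0 f + x * S 0 1 1 f) + S 0 0 1 f
      ≡⟨ collect x (S 1 0 0 f) (S 1 1 0 f) (S 1 1 1 f) (S 0 1 0 f) (S 0 1 1 f) (S 0 0 1 f) ⟩
    tileStep x f n₁ n₂ n₃ ∎
    where
    f g₁ g₂ g₃ : Grid
    f = ungraded wordSum
    g₁ = ungraded (sumAfter c₁)
    g₂ = ungraded (sumAfter c₂)
    g₃ = ungraded (sumAfter c₃)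
    S : ℕ → ℕ → ℕ → Grid → ℤ
    S k₁ k₂ k₃ F = shift k₁ k₂ k₃ F n₁ n₂ n₃
    g₃≡f : ∀ k₁ k₂ k₃ → S k₁ k₂ k₃ g₃ ≡ S k₁ k₂ k₃ f
    g₃≡f k₁ k₂ k₃ = shift-cong k₁ k₂ k₃ n₁ n₂ n₃ λ a b c _ _ _ → ungraded-sumAfter-c₃ a b c
    collect : ∀ x A B C D E F → A + x * (B + x * C) + (D + x * E) + F ≡ A + D + F + x * B + x * E + x * x * C
    collect = solve-∀

  P₃-as-wordSum : ∀ n₁ n₂ n₃ → P₃ w n₁ n₂ n₃ ≡ ungraded wordSum n₁ n₂ n₃
  P₃-as-wordSum n₁ n₂ n₃ = begin
    P₃ w n₁ n₂ n₃
      ≡⟨ sumTo-levels N rises (w ^_) (words₃ n₁ n₂ n₃) (AllP.filter⁺ _ (All.map (λ {as} → rises≤N {as}) (allSeqs-length N))) ⟩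
    sumOver (words₃ n₁ n₂ n₃) (λ as → w ^ rises as)
      ≡⟨ sumOver-filter _ (allSeqs N) _ ⟩
    sumOver (allSeqs N) (λ as → if does (hasContent n₁ n₂ n₃ as Bool.≟ true) then w ^ rises as else 0ℤ)
      ≡⟨ sumOver-cong (allSeqs N) (λ as → cong (if_then w ^ rises as else 0ℤ) (does-≟-true (hasContent n₁ n₂ n₃ as))) ⟩
    wordSum N n₁ n₂ n₃ ∎
    where
    N = n₁ ℕ.+ n₂ ℕ.+ n₃
    rises≤N : ∀ {as} → length as ≡ N → rises as ℕ.≤ N
    rises≤N {as} e = subst (rises as ℕ.≤_) e (rises≤length as)
    does-≟-true : ∀ b → does (b Bool.≟ true) ≡ b
    does-≟-true true  = refl
    does-≟-true false = refl

corollary4 : (n₁ n₂ n₃ : ℕ) (w : ℤ) → P₃ w n₁ n₂ n₃ ≡ RHS₃ w n₁ n₂ n₃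
corollary4 n₁ n₂ n₃ w = begin
  P₃ w n₁ n₂ n₃                  ≡⟨ P₃-as-wordSum n₁ n₂ n₃ ⟩
  ungraded wordSum n₁ n₂ n₃      ≡⟨ tileRecurrence-unique x wordSum-recurrence (boxSum-recurrence φ-pascal) refl n₁ n₂ n₃ ⟩
  boxSum n₁ n₂ n₃                ≡⟨ boxSum-RHS₃ n₁ n₂ n₃ ⟩
  RHS₃ w n₁ n₂ n₃                ∎
  where
  open Words w
  open MultinomialSum w
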